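{- Let $L_{\mathcal{C}}=\{ww\mid w\in\{0,1\}^*\}$ be the binary copy language. Then every graph is $L_{\mathcal{C}}$-representable, i.e., $\mathcal{G}_{L_{\mathcal{C}}}$ is the class of all graphs.
   Context: All graphs are finite, simple, undirected, with nonempty vertex sets, and graph classes are considered up to isomorphism. For an alphabet $V$ and distinct $u,v\in V$, $h_{u,v}:V^*\to\{0,1\}^*$ is the monoid morphism with $u\mapsto 0$, $v\mapsto 1$ and $x\mapsto\lambda$ (empty word) for all other letters $x$. For a language $L\subseteq\{0,1\}^*$ closed under exchanging 0 and 1 and a nonempty word $w$ whose set of occurring letters is $V$, $G(L,w)$ is the graph with vertex set $V$ in which distinct $u,v$ are adjacent iff $h_{u,v}(w)\in L$. A graph is $L$-representable if it is isomorphic to some $G(L,w)$; $\mathcal{G}_L$ is the class of $L$-representable graphs. -}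

module Defs where

open import Data.Nat using (ℕ; suc)
open import Data.Fin using (Fin; _≟_)
open import Data.Bool using (Bool; true; false)
open import Data.List using (List; []; _∷_; _++_)
open import Data.List.Membership.Propositional using (_∈_)
open import Data.Product using (Σ; _×_; ∃)
open import Function.Bundles using (_⤖_; _⇔_; Bijection)
open import Relation.Binary.PropositionalEquality using (_≡_; _≢_)
open import Relation.Nullary using (yes; no)

record Graph : Set where
  field
    n      : ℕ
    adj    : Fin (suc n) → Fin (suc n) → Bool
    sym    : ∀ u v → adj u v ≡ adj v u
    irrefl : ∀ u → adj u u ≡ false

-- binary words: 0 = false, 1 = true
Word₂ : Set
Word₂ = List Bool

Language : Set₁
Language = Word₂ → Set

h : ∀ {m} → Fin m → Fin m → List (Fin m) → Word₂
h u v [] = []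
h u v (x ∷ w) with x ≟ u | x ≟ v
... | yes _ | _     = false ∷ h u v w
... | no _  | yes _ = true ∷ h u v w
... | no _  | no _  = h u v w

GAdj : Language → ∀ {m} → List (Fin m) → Fin m → Fin m → Set
GAdj L w u v = (u ≢ v) × L (h u v w)

-- G is L-representable: there is a word w over an alphabet Fin m in which
-- every letter of the alphabet occurs (so the vertex set of G(L,w) is Fin m),
-- and a graph isomorphism from G to G(L,w).
Representable : Language → Graph → Set
Representable L G =
  Σ ℕ λ m → Σ (List (Fin m)) λ w →
    (∀ x → x ∈ w) ×
    Σ (Fin (suc (Graph.n G)) ⤖ Fin m) λ f →
      ∀ a b → (Graph.adj G a b ≡ true) ⇔ GAdj L w (Bijection.to f a) (Bijection.to f b)

CopyLang : Language
CopyLang x = ∃ λ (w : Word₂) → x ≡ w ++ w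

{-# OPTIONS --safe #-}
module Submission where

-- Let A list all vertices, let X concatenate the blocks a b over all non-edges (a , b),
-- and let Y concatenate the swapped blocks b a. Take w = A X A Y. Under h_{u,v} every
-- block and its swap have images of equal length, and equal images unless the block
-- consists of u and v themselves, where they become 01 and 10. So h_{u,v}(w) is
-- A' X' A' Y' with |X'| = |Y'|, which is a square iff X' = Y', i.e. iff uv is an edge.

open import Defs
open import Data.Nat using (ℕ; zero; suc; _+_)
open import Data.Nat.Properties using (+-comm; +-suc; suc-injective)
open import Data.Fin using (Fin; _≟_)
open import Data.Bool using (true; false; if_then_else_)
open import Data.List using (List; []; _∷_; _++_; length; concatMap; allFin; cartesianProduct)
open import Data.List.Properties using (length-++; ++-cancelˡ; ∷-injective; concatMap-cong)
open import Data.List.Membership.Propositional using (_∈_)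
open import Data.List.Membership.Propositional.Properties using (∈-allFin; ∈-cartesianProduct⁺; ∈-++⁺ˡ)
open import Data.List.Relation.Unary.Any using (here; there)
open import Data.Product using (_×_; _,_; proj₁; proj₂)
open import Data.Empty using (⊥-elim)
open import Function using (_∘_; case_of_)
open import Function.Bundles using (_⇔_; mk⇔; Equivalence)
open import Function.Construct.Identity using (⤖-id)
open import Relation.Binary.PropositionalEquality
open import Relation.Nullary using (yes; no; ¬_)

m+m≡n+n⇒m≡n : ∀ {m n} → m + m ≡ n + n → m ≡ n
m+m≡n+n⇒m≡n {zero}  {zero}  _ = refl
m+m≡n+n⇒m≡n {suc m} {suc n} e rewrite +-suc m m | +-suc n n =
  cong suc (m+m≡n+n⇒m≡n (suc-injective (suc-injective e)))

module _ {A : Set} where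

  ++-injective : ∀ (xs ys : List A) {zs ws} → length xs ≡ length ys →
                 xs ++ zs ≡ ys ++ ws → xs ≡ ys × zs ≡ ws
  ++-injective []       []       _ e = refl , e
  ++-injective (x ∷ xs) (y ∷ ys) l e with ∷-injective e
  ... | refl , e′ with ++-injective xs ys (suc-injective l) e′
  ...   | refl , zs≡ws = refl , zs≡ws

  square-halves : ∀ {xs ys z : List A} → length xs ≡ length ys →
                  xs ++ ys ≡ z ++ z → xs ≡ ys
  square-halves {xs} {ys} {z} l e = trans xs≡z (sym ys≡z)
    where
      length-xs≡length-z : length xs ≡ length z
      length-xs≡length-z = m+m≡n+n⇒m≡n (begin
        length xs + length xs ≡⟨ cong (length xs +_) l ⟩
        length xs + length ys ≡⟨ length-++ xs ⟨
        length (xs ++ ys)     ≡⟨ cong length e ⟩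
        length (z ++ z)       ≡⟨ length-++ z ⟩
        length z + length z   ∎)
        where open ≡-Reasoning
      xs≡z = proj₁ (++-injective xs z length-xs≡length-z e)
      ys≡z = proj₂ (++-injective xs z length-xs≡length-z e)

CopyLang-halves : ∀ {xs ys : Word₂} → length xs ≡ length ys → CopyLang (xs ++ ys) ⇔ xs ≡ ys
CopyLang-halves {xs} l = mk⇔
  (λ (z , e) → square-halves {z = z} l e)
  (λ xs≡ys → xs , cong (xs ++_) (sym xs≡ys))

module _ {A B : Set} {f g : A → List B} (length-f≡g : ∀ x → length (f x) ≡ length (g x)) where

  length-concatMap-≡ : ∀ xs → length (concatMap f xs) ≡ length (concatMap g xs)
  length-concatMap-≡ []       = refl
  length-concatMap-≡ (x ∷ xs) = begin
    length (f x ++ concatMap f xs)              ≡⟨ length-++ (f x) ⟩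
    length (f x) + length (concatMap f xs)      ≡⟨ cong₂ _+_ (length-f≡g x) (length-concatMap-≡ xs) ⟩
    length (g x) + length (concatMap g xs)      ≡⟨ length-++ (g x) ⟨
    length (g x ++ concatMap g xs)              ∎
    where open ≡-Reasoning

  concatMap-≡⇒≡ : ∀ {xs x} → concatMap f xs ≡ concatMap g xs → x ∈ xs → f x ≡ g x
  concatMap-≡⇒≡ {y ∷ _} e (here refl) = proj₁ (++-injective (f y) (g y) (length-f≡g y) e)
  concatMap-≡⇒≡ {y ∷ _} e (there x∈xs) =
    concatMap-≡⇒≡ (proj₂ (++-injective (f y) (g y) (length-f≡g y) e)) x∈xs

module _ {m : ℕ} (u v : Fin m) where

  h-++ : ∀ xs ys → h u v (xs ++ ys) ≡ h u v xs ++ h u v ys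
  h-++ []       ys = refl
  h-++ (x ∷ xs) ys with x ≟ u | x ≟ v
  ... | yes _ | _     = cong (false ∷_) (h-++ xs ys)
  ... | no _  | yes _ = cong (true ∷_) (h-++ xs ys)
  ... | no _  | no _  = h-++ xs ys

  h-concatMap : ∀ {A : Set} (f : A → List (Fin m)) xs →
                h u v (concatMap f xs) ≡ concatMap (h u v ∘ f) xs
  h-concatMap f []       = refl
  h-concatMap f (x ∷ xs) =
    trans (h-++ (f x) (concatMap f xs)) (cong (h u v (f x) ++_) (h-concatMap f xs))

  length-h-++-comm : ∀ xs ys → length (h u v (xs ++ ys)) ≡ length (h u v (ys ++ xs))
  length-h-++-comm xs ys = begin
    length (h u v (xs ++ ys))               ≡⟨ cong length (h-++ xs ys) ⟩
    length (h u v xs ++ h u v ys)           ≡⟨ length-++ (h u v xs) ⟩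
    length (h u v xs) + length (h u v ys)   ≡⟨ +-comm (length (h u v xs)) _ ⟩
    length (h u v ys) + length (h u v xs)   ≡⟨ length-++ (h u v ys) ⟨
    length (h u v ys ++ h u v xs)           ≡⟨ cong length (h-++ ys xs) ⟨
    length (h u v (ys ++ xs))               ∎
    where open ≡-Reasoning

  h-swap : ∀ a b → ¬ (a ≡ u × b ≡ v) → ¬ (a ≡ v × b ≡ u) →
           h u v (a ∷ b ∷ []) ≡ h u v (b ∷ a ∷ [])
  -- Splitting into single letters first puts all four tests at top level, where with can see them.
  h-swap a b ¬uv ¬vu rewrite h-++ (a ∷ []) (b ∷ []) | h-++ (b ∷ []) (a ∷ [])
    with a ≟ u | a ≟ v | b ≟ u | b ≟ v
  ... | yes _   | _       | yes _   | _       = refl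
  ... | yes a≡u | _       | no _    | yes b≡v = ⊥-elim (¬uv (a≡u , b≡v))
  ... | yes _   | _       | no _    | no _    = refl
  ... | no _    | yes a≡v | yes b≡u | _       = ⊥-elim (¬vu (a≡v , b≡u))
  ... | no _    | yes _   | no _    | yes _   = refl
  ... | no _    | yes _   | no _    | no _    = refl
  ... | no _    | no _    | yes _   | _       = refl
  ... | no _    | no _    | no _    | yes _   = refl
  ... | no _    | no _    | no _    | no _    = refl

  h-uv≢h-vu : u ≢ v → h u v (u ∷ v ∷ []) ≢ h u v (v ∷ u ∷ [])
  h-uv≢h-vu u≢v rewrite h-++ (u ∷ []) (v ∷ []) | h-++ (v ∷ []) (u ∷ [])
    with u ≟ u | u ≟ v | v ≟ u | v ≟ v
  ... | no u≢u | _     | _     | _      = ⊥-elim (u≢u refl)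
  ... | yes _  | _     | yes v≡u | _    = ⊥-elim (u≢v (sym v≡u))
  ... | yes _  | _     | no _  | no v≢v = ⊥-elim (v≢v refl)
  ... | yes _  | _     | no _  | yes _  = λ ()

module Construction (G : Graph) where
  open Graph G using (n; adj; irrefl)

  V : Set
  V = Fin (suc n)

  forward backward : V × V → List V
  forward  (a , b) = if adj a b then [] else a ∷ b ∷ []
  backward (a , b) = if adj a b then [] else b ∷ a ∷ []

  pairs : List (V × V)
  pairs = cartesianProduct (allFin (suc n)) (allFin (suc n))

  word : List V
  word = (allFin (suc n) ++ concatMap forward pairs) ++ (allFin (suc n) ++ concatMap backward pairs)

  module _ (u v : V) where

    length-h-forward≡backward : ∀ p → length (h u v (forward p)) ≡ length (h u v (backward p))
    length-h-forward≡backward (a , b) with adj a b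
    ... | true  = refl
    ... | false = length-h-++-comm u v (a ∷ []) (b ∷ [])

    h-forward≡backward : adj u v ≡ true → ∀ p → h u v (forward p) ≡ h u v (backward p)
    h-forward≡backward uv (a , b) with adj a b in ab
    ... | true  = refl
    ... | false = h-swap u v a b
      (λ { (refl , refl) → case trans (sym uv) ab of λ () })
      (λ { (refl , refl) → case trans (sym uv) (trans (Graph.sym G _ _) ab) of λ () })

    h-forward≢backward : u ≢ v → adj u v ≡ false → h u v (forward (u , v)) ≢ h u v (backward (u , v))
    h-forward≢backward u≢v uv rewrite uv = h-uv≢h-vu u v u≢v

    A′ X Y : Word₂
    A′ = h u v (allFin (suc n))
    X  = concatMap (h u v ∘ forward) pairs
    Y  = concatMap (h u v ∘ backward) pairs

    h-word : h u v word ≡ (A′ ++ X) ++ (A′ ++ Y)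
    h-word = begin
      h u v word
        ≡⟨ h-++ u v (allFin (suc n) ++ concatMap forward pairs) (allFin (suc n) ++ concatMap backward pairs) ⟩
      h u v (allFin (suc n) ++ concatMap forward pairs) ++ h u v (allFin (suc n) ++ concatMap backward pairs)
        ≡⟨ cong₂ _++_ (h-++ u v (allFin (suc n)) (concatMap forward pairs))
                      (h-++ u v (allFin (suc n)) (concatMap backward pairs)) ⟩
      (A′ ++ h u v (concatMap forward pairs)) ++ (A′ ++ h u v (concatMap backward pairs))
        ≡⟨ cong₂ (λ x y → (A′ ++ x) ++ (A′ ++ y)) (h-concatMap u v forward pairs) (h-concatMap u v backward pairs) ⟩
      (A′ ++ X) ++ (A′ ++ Y) ∎
      where open ≡-Reasoning

    length-X≡Y : length X ≡ length Y
    length-X≡Y = length-concatMap-≡ {f = h u v ∘ forward} {g = h u v ∘ backward} length-h-forward≡backward pairs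

    CopyLang-word⇔X≡Y : CopyLang (h u v word) ⇔ X ≡ Y
    CopyLang-word⇔X≡Y = mk⇔
      (λ c → ++-cancelˡ A′ X Y (Equivalence.to halves (subst CopyLang h-word c)))
      (λ X≡Y → subst CopyLang (sym h-word) (Equivalence.from halves (cong (A′ ++_) X≡Y)))
      where
        halves : CopyLang ((A′ ++ X) ++ (A′ ++ Y)) ⇔ A′ ++ X ≡ A′ ++ Y
        halves = CopyLang-halves (begin
          length (A′ ++ X)      ≡⟨ length-++ A′ ⟩
          length A′ + length X  ≡⟨ cong (length A′ +_) length-X≡Y ⟩
          length A′ + length Y  ≡⟨ length-++ A′ ⟨
          length (A′ ++ Y)      ∎)
          where open ≡-Reasoning

    adj⇒X≡Y : adj u v ≡ true → X ≡ Y
    adj⇒X≡Y uv = concatMap-cong (h-forward≡backward uv) pairs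

    X≡Y⇒adj : u ≢ v → X ≡ Y → adj u v ≡ true
    X≡Y⇒adj u≢v X≡Y with adj u v in uv
    ... | true  = refl
    ... | false = ⊥-elim (h-forward≢backward u≢v uv
      (concatMap-≡⇒≡ {f = h u v ∘ forward} {g = h u v ∘ backward} length-h-forward≡backward X≡Y
                     (∈-cartesianProduct⁺ (∈-allFin u) (∈-allFin v))))

    adj⇔GAdj : adj u v ≡ true ⇔ GAdj CopyLang word u v
    adj⇔GAdj = mk⇔
      (λ uv → (λ { refl → case trans (sym uv) (irrefl u) of λ () }) ,
            Equivalence.from CopyLang-word⇔X≡Y (adj⇒X≡Y uv))
      (λ (u≢v , c) → X≡Y⇒adj u≢v (Equivalence.to CopyLang-word⇔X≡Y c))

mainTheorem10 : (G : Graph) → Representable CopyLang G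
mainTheorem10 G = suc n , word , (λ x → ∈-++⁺ˡ (∈-++⁺ˡ (∈-allFin x))) , ⤖-id _ , adj⇔GAdj
  where open Graph G using (n)
        open Construction G
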